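{- Let $\mathcal D$ be a maximal BSPD on a finite set $A$ with $n=|A|\ge3$, and let $a_1,a_2$ be the two bottom alternatives of $\mathcal D$. For $i\in\{1,2\}$ let $\mathcal D_i=\{\omega_{A\setminus\{a_i\}}:\omega\in\mathcal D,\ \omega(n)=a_i\}$ and let $\mathcal D'=\{\omega_{A\setminus\{a_1,a_2\}}:\omega\in\mathcal D,\ \omega(n)=a_1,\ \omega(n-1)=a_2\}$. Then $\mathcal D_1$, $\mathcal D_2$ and $\mathcal D'$ are maximal BSPDs (on $A\setminus\{a_1\}$, $A\setminus\{a_2\}$, $A\setminus\{a_1,a_2\}$ respectively).
   Context: Preferences: bijections $\omega\colon[n]\to A$, written $\omega(1)\cdots\omega(n)$ ($\omega(1)$ most preferred; $a>_\omega b$ if $a$ appears before $b$); $\mathcal L(A)$ all preferences; domain = subset of $\mathcal L(A)$; $\omega_S$ = restriction of $\omega$ to $S\subseteq A$ keeping relative order; $x$ is a bottom alternative of $\mathcal D$ if $\omega(|A|)=x$ for some $\omega\in\mathcal D$. A domain $\mathcal D$ is a Black's single-peaked domain (BSPD) if there is a path graph $P$ on vertex set $A$ such that for all $\omega\in\mathcal D$ and distinct $a,b\in A$, $a>_\omega b$ whenever $a$ lies on the path in $P$ from $\omega(1)$ to $b$; a maximal BSPD is one not properly contained in another BSPD on $A$. Known facts: a maximal BSPD is a maximal ASPD (an ASPD being a domain such that for every 3-element $T\subseteq A$ some element of $T$ is never last in the restriction to $T$), and a maximal ASPD on $n\ge2$ alternatives has exactly two bottom alternatives. -}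

module Defs where

open import Data.List using (List; []; _∷_; _++_; _∷ʳ_; filter; length)
open import Data.List.Membership.Propositional using (_∈_)
open import Data.List.Relation.Binary.Permutation.Propositional using (_↭_)
open import Data.Product using (Σ; ∃; ∃₂; _×_; _,_)
open import Data.Sum using (_⊎_)
open import Relation.Binary.PropositionalEquality using (_≡_; _≢_)
open import Relation.Binary.Definitions using (DecidableEquality)
open import Relation.Nullary using (¬?)

module _ {X : Set} (_≟_ : DecidableEquality X) where

  -- A preference on the alternative set A (a duplicate-free list) is a list
  -- ω = ω(1) ω(2) ... ω(n) enumerating A exactly once, i.e. a permutation of A.
  IsPref : List X → List X → Set
  IsPref A ω = ω ↭ A

  Before : List X → X → X → Set
  Before ω a b = ∃₂ λ xs ys → (ω ≡ xs ++ (a ∷ ys)) × (b ∈ ys)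

  WBefore : List X → X → X → Set
  WBefore ω a b = (a ≡ b) ⊎ Before ω a b

  -- A path graph P on A is given by the sequence p of its vertices along the path
  -- (p a permutation of A).  The path in P from u to b consists of the vertices
  -- lying between u and b (inclusive) in p.
  OnPath : List X → X → X → X → Set
  OnPath p u b a = (WBefore p u a × WBefore p a b) ⊎ (WBefore p b a × WBefore p a u)

  SinglePeakedWrt : List X → List X → Set
  SinglePeakedWrt p ω = ∀ top rest → ω ≡ top ∷ rest →
    ∀ a b → a ≢ b → OnPath p top b a → Before ω a b

  IsDomain : List X → (List X → Set) → Set
  IsDomain A D = ∀ ω → D ω → IsPref A ω

  IsBSPD : List X → (List X → Set) → Set
  IsBSPD A D = IsDomain A D × (∃ λ p → (p ↭ A) × (∀ ω → D ω → SinglePeakedWrt p ω))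

  IsMaximalBSPD : List X → (List X → Set) → Set₁
  IsMaximalBSPD A D = IsBSPD A D ×
    ((D' : List X → Set) → IsBSPD A D' → (∀ ω → D ω → D' ω) → ∀ ω → D' ω → D ω)

  IsBottom : (List X → Set) → X → Set
  IsBottom D x = ∃ λ ω → D ω × ∃ λ xs → ω ≡ xs ∷ʳ x

  remove : X → List X → List X
  remove a = filter (λ x → ¬? (x ≟ a))

  BottomRestrict : (List X → Set) → X → List X → Set
  BottomRestrict D a ω' = ∃ λ ω → D ω × (∃ λ xs → ω ≡ xs ∷ʳ a) × (ω' ≡ remove a ω)

  BottomRestrict₂ : (List X → Set) → X → X → List X → Set
  BottomRestrict₂ D a₁ a₂ ω' = ∃ λ ω → D ω × (∃ λ xs → ω ≡ xs ++ (a₂ ∷ a₁ ∷ []))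
    × (ω' ≡ remove a₂ (remove a₁ ω))

{-# OPTIONS --safe #-}
-- A maximal BSPD with path p is exactly the set of all preferences on A that are
-- single-peaked w.r.t. p: adding them keeps a BSPD for p; conversely, a BSPD
-- containing them contains p and its reverse, and since the middle one of three
-- alternatives on a path is never ranked last, its path has the same betweenness
-- as p, so all its preferences are single-peaked w.r.t. p.  By the same fact a
-- bottom alternative c is an endpoint of p, so ω ↦ ω ∖ c maps the preferences of
-- D ending in c onto the preferences on A ∖ c single-peaked w.r.t. the path p ∖ c:
-- D_c is again a full single-peaked domain, hence maximal.  Finally D′ is the
-- restriction of D_{a₁} at a₂, which is an endpoint of p ∖ a₁.
module Submission where

open import Defs
open import Data.Empty using (⊥-elim)
open import Data.List using (List; []; _∷_; _++_; _∷ʳ_; [_]; filter; length; reverse)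
open import Data.List.Properties
  using (++-assoc; ++-identityʳ; ∷-injectiveˡ; unfold-reverse; reverse-involutive;
         filter-accept; filter-reject; filter-all; filter-++)
open import Data.List.Membership.Propositional using (_∈_; _∉_)
open import Data.List.Membership.Propositional.Properties using (∈-++⁺ˡ; ∈-++⁺ʳ; ∈-∃++; ∈-filter⁺; ∈-filter⁻)
import Data.List.Relation.Unary.All as All
open import Data.List.Relation.Unary.AllPairs using ([]; _∷_)
open import Data.List.Relation.Unary.Any using (here; there)
open import Data.List.Relation.Unary.Any.Properties using (reverse⁺)
open import Data.List.Relation.Unary.Unique.Propositional using (Unique)
open import Data.List.Relation.Unary.Unique.Propositional.Properties using (filter⁺; Unique[x∷xs]⇒x∉xs)
open import Data.List.Relation.Binary.Permutation.Propositional using (_↭_; prep; swap; ↭-refl; ↭-sym; ↭-trans; ↭-reflexive; ↭⇒↭ₛ)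
open import Data.List.Relation.Binary.Permutation.Propositional.Properties using (∈-resp-↭; ↭-reverse; ∷↭∷ʳ; filter-↭)
import Data.List.Relation.Binary.Permutation.Setoid.Properties as Permutationₛ
open import Data.Nat using (_≥_)
open import Data.Product using (∃; ∃₂; _×_; _,_; proj₁; proj₂)
open import Data.Sum as Sum using (_⊎_; inj₁; inj₂)
open import Function using (_∘_; id)
open import Relation.Binary.Definitions using (DecidableEquality)
open import Relation.Binary.PropositionalEquality using (_≡_; _≢_; refl; sym; trans; cong; subst; setoid; module ≡-Reasoning)
open import Relation.Nullary using (¬_; yes; no; ¬?)
open import Level using (0ℓ)
open import Relation.Unary using (Pred; Decidable; _⊆_; _≐_; _∪_)
open import Relation.Unary.Properties using (≐-trans)

module BlackSinglePeaked {X : Set} (_≟_ : DecidableEquality X) where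

  open Permutationₛ (setoid X) using (Unique-resp-↭)

  infix 4 _≺[_]_ _≼[_]_
  infixl 6 _∖_

  _≺[_]_ : X → List X → X → Set
  a ≺[ l ] b = Before _≟_ l a b

  _≼[_]_ : X → List X → X → Set
  a ≼[ l ] b = WBefore _≟_ l a b

  OnSegment : List X → X → X → X → Set
  OnSegment = OnPath _≟_

  SinglePeaked : List X → List X → Set
  SinglePeaked = SinglePeakedWrt _≟_

  _∖_ : List X → X → List X
  l ∖ c = remove _≟_ c l

  ≢-dec : (c : X) → Decidable (_≢ c)
  ≢-dec c x = ¬? (x ≟ c)

  private variable
    a b c m t u v w x y : X
    l p q r xs ω : List X

  ≺-[]⁻ : ¬ a ≺[ [] ] b
  ≺-[]⁻ ([] , _ , () , _)
  ≺-[]⁻ (_ ∷ _ , _ , () , _)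

  ≺-here : b ∈ l → a ≺[ a ∷ l ] b
  ≺-here b∈l = [] , _ , refl , b∈l

  ≺-there : a ≺[ l ] b → a ≺[ x ∷ l ] b
  ≺-there {x = x} (xs , ys , refl , b∈ys) = x ∷ xs , ys , refl , b∈ys

  ≺-∷⁻ : a ≺[ x ∷ l ] b → (x ≡ a × b ∈ l) ⊎ a ≺[ l ] b
  ≺-∷⁻ ([] , _ , refl , b∈ys) = inj₁ (refl , b∈ys)
  ≺-∷⁻ (_ ∷ xs , ys , refl , b∈ys) = inj₂ (xs , ys , refl , b∈ys)

  ≺⇒∈ˡ : a ≺[ l ] b → a ∈ l
  ≺⇒∈ˡ (xs , _ , refl , _) = ∈-++⁺ʳ xs (here refl)

  ≺⇒∈ʳ : a ≺[ l ] b → b ∈ l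
  ≺⇒∈ʳ (xs , _ , refl , b∈ys) = ∈-++⁺ʳ xs (there b∈ys)

  ≺-irrefl : Unique l → ¬ a ≺[ l ] a
  ≺-irrefl [] a≺a = ≺-[]⁻ a≺a
  ≺-irrefl (x∉l ∷ l-unique) a≺a with ≺-∷⁻ a≺a
  ... | inj₁ (refl , x∈l) = All.lookup x∉l x∈l refl
  ... | inj₂ a≺a′ = ≺-irrefl l-unique a≺a′

  ≺⇒≢ : Unique l → a ≺[ l ] b → a ≢ b
  ≺⇒≢ l-unique a≺a refl = ≺-irrefl l-unique a≺a

  ≺-trans : Unique l → a ≺[ l ] b → b ≺[ l ] c → a ≺[ l ] c
  ≺-trans [] a≺b _ = ⊥-elim (≺-[]⁻ a≺b)
  ≺-trans (x∉l ∷ l-unique) a≺b b≺c with ≺-∷⁻ a≺b | ≺-∷⁻ b≺c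
  ... | inj₁ (refl , b∈l) | inj₁ (refl , _) = ⊥-elim (All.lookup x∉l b∈l refl)
  ... | inj₁ (refl , _)   | inj₂ b≺c′      = ≺-here (≺⇒∈ʳ b≺c′)
  ... | inj₂ a≺b′         | inj₁ (refl , _) = ⊥-elim (All.lookup x∉l (≺⇒∈ʳ a≺b′) refl)
  ... | inj₂ a≺b′         | inj₂ b≺c′      = ≺-there (≺-trans l-unique a≺b′ b≺c′)

  ≺-asym : Unique l → a ≺[ l ] b → ¬ b ≺[ l ] a
  ≺-asym l-unique a≺b b≺a = ≺-irrefl l-unique (≺-trans l-unique a≺b b≺a)

  ≺-total : a ∈ l → b ∈ l → a ≢ b → a ≺[ l ] b ⊎ b ≺[ l ] a
  ≺-total (here refl) (here refl) a≢b = ⊥-elim (a≢b refl)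
  ≺-total (here refl) (there b∈l) _   = inj₁ (≺-here b∈l)
  ≺-total (there a∈l) (here refl) _   = inj₂ (≺-here a∈l)
  ≺-total (there a∈l) (there b∈l) a≢b = Sum.map ≺-there ≺-there (≺-total a∈l b∈l a≢b)

  ≼-total : a ∈ l → b ∈ l → a ≼[ l ] b ⊎ b ≼[ l ] a
  ≼-total {a} {b = b} a∈l b∈l with a ≟ b
  ... | yes a≡b = inj₁ (inj₁ a≡b)
  ... | no a≢b  = Sum.map inj₂ inj₂ (≺-total a∈l b∈l a≢b)

  ≺-head⁻ : Unique (x ∷ l) → ¬ a ≺[ x ∷ l ] x
  ≺-head⁻ (x∉l ∷ _) a≺x with ≺-∷⁻ a≺x
  ... | inj₁ (refl , x∈l) = All.lookup x∉l x∈l refl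
  ... | inj₂ a≺x′ = All.lookup x∉l (≺⇒∈ʳ a≺x′) refl

  ≺-last⁻ : ∀ xs → Unique (xs ∷ʳ c) → ¬ c ≺[ xs ∷ʳ c ] a
  ≺-last⁻ [] _ c≺a with ≺-∷⁻ c≺a
  ... | inj₁ (_ , ())
  ... | inj₂ c≺a′ = ≺-[]⁻ c≺a′
  ≺-last⁻ (x ∷ xs) (x∉ ∷ unique) c≺a with ≺-∷⁻ c≺a
  ... | inj₁ (refl , _) = All.lookup x∉ (∈-++⁺ʳ xs (here refl)) refl
  ... | inj₂ c≺a′ = ≺-last⁻ xs unique c≺a′

  ≺-∷ʳ : a ∈ l → a ≺[ l ∷ʳ x ] x
  ≺-∷ʳ {a} {x = x} a∈l with xs , ys , refl ← ∈-∃++ a∈l =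
    xs , ys ∷ʳ x , ++-assoc xs (a ∷ ys) [ x ] , ∈-++⁺ʳ ys (here refl)

  ≺-++ʳ : ∀ r → a ≺[ l ] b → a ≺[ l ++ r ] b
  ≺-++ʳ {a} r (xs , ys , refl , b∈ys) = xs , ys ++ r , ++-assoc xs (a ∷ ys) r , ∈-++⁺ˡ b∈ys

  ≺-reverse⁺ : a ≺[ l ] b → b ≺[ reverse l ] a
  ≺-reverse⁺ {l = []} a≺b = ⊥-elim (≺-[]⁻ a≺b)
  ≺-reverse⁺ {l = x ∷ l} a≺b rewrite unfold-reverse x l with ≺-∷⁻ a≺b
  ... | inj₁ (refl , b∈l) = ≺-∷ʳ (reverse⁺ b∈l)
  ... | inj₂ a≺b′ = ≺-++ʳ [ x ] (≺-reverse⁺ a≺b′)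

  ≺-reverse⁻ : a ≺[ reverse l ] b → b ≺[ l ] a
  ≺-reverse⁻ {l = l} a≺b = subst (_ ≺[_] _) (reverse-involutive l) (≺-reverse⁺ a≺b)

  ≼-reverse⁺ : a ≼[ l ] b → b ≼[ reverse l ] a
  ≼-reverse⁺ (inj₁ a≡b) = inj₁ (sym a≡b)
  ≼-reverse⁺ (inj₂ a≺b) = inj₂ (≺-reverse⁺ a≺b)

  unique-resp-↭ : l ↭ r → Unique l → Unique r
  unique-resp-↭ l↭r = Unique-resp-↭ (↭⇒↭ₛ l↭r)

  ∷ʳ-unique⇒∉ : ∀ xs → Unique (xs ∷ʳ c) → c ∉ xs
  ∷ʳ-unique⇒∉ xs unique = Unique[x∷xs]⇒x∉xs (unique-resp-↭ (↭-sym (∷↭∷ʳ _ xs)) unique)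

  onSegment⇒≡∨∈ : OnSegment p t b a → a ≡ t ⊎ a ∈ p
  onSegment⇒≡∨∈ (inj₁ (inj₁ t≡a , _)) = inj₁ (sym t≡a)
  onSegment⇒≡∨∈ (inj₁ (inj₂ t≺a , _)) = inj₂ (≺⇒∈ʳ t≺a)
  onSegment⇒≡∨∈ (inj₂ (_ , inj₁ a≡t)) = inj₁ a≡t
  onSegment⇒≡∨∈ (inj₂ (_ , inj₂ a≺t)) = inj₂ (≺⇒∈ˡ a≺t)

  onSegment⇒∈ : a ≢ b → OnSegment p t b a → b ∈ p
  onSegment⇒∈ a≢b (inj₁ (_ , inj₁ a≡b)) = ⊥-elim (a≢b a≡b)
  onSegment⇒∈ _   (inj₁ (_ , inj₂ a≺b)) = ≺⇒∈ʳ a≺b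
  onSegment⇒∈ a≢b (inj₂ (inj₁ b≡a , _)) = ⊥-elim (a≢b (sym b≡a))
  onSegment⇒∈ _   (inj₂ (inj₂ b≺a , _)) = ≺⇒∈ˡ b≺a

  singlePeaked-self : Unique p → SinglePeaked p p
  singlePeaked-self p-unique t r refl a b a≢b on-ab with on-ab
  ... | inj₁ (_ , inj₁ a≡b)           = ⊥-elim (a≢b a≡b)
  ... | inj₁ (_ , inj₂ a≺b)           = a≺b
  ... | inj₂ (_ , inj₂ a≺t)           = ⊥-elim (≺-head⁻ p-unique a≺t)
  ... | inj₂ (inj₁ b≡a , inj₁ refl)  = ⊥-elim (a≢b (sym b≡a))
  ... | inj₂ (inj₂ b≺t , inj₁ refl)  = ⊥-elim (≺-head⁻ p-unique b≺t)

  onSegment-reverse⁺ : OnSegment p t b a → OnSegment (reverse p) t b a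
  onSegment-reverse⁺ (inj₁ (t≼a , a≼b)) = inj₂ (≼-reverse⁺ a≼b , ≼-reverse⁺ t≼a)
  onSegment-reverse⁺ (inj₂ (b≼a , a≼t)) = inj₁ (≼-reverse⁺ a≼t , ≼-reverse⁺ b≼a)

  singlePeaked-reverse : Unique p → SinglePeaked p (reverse p)
  singlePeaked-reverse {p} p-unique t r eq a b a≢b on-ab =
    singlePeaked-self (unique-resp-↭ (↭-sym (↭-reverse p)) p-unique) t r eq a b a≢b
                      (onSegment-reverse⁺ on-ab)

  Between : List X → X → X → X → Set
  Between q u v w = (u ≺[ q ] v × v ≺[ q ] w) ⊎ (w ≺[ q ] v × v ≺[ q ] u)

  between⇒∈ : Between q u v w → v ∈ q
  between⇒∈ (inj₁ (_ , v≺w)) = ≺⇒∈ˡ v≺w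
  between⇒∈ (inj₂ (_ , v≺u)) = ≺⇒∈ˡ v≺u

  between⇒onSegment : Between q t a b → OnSegment q t b a
  between⇒onSegment (inj₁ (t≺a , a≺b)) = inj₁ (inj₂ t≺a , inj₂ a≺b)
  between⇒onSegment (inj₂ (b≺a , a≺t)) = inj₂ (inj₂ b≺a , inj₂ a≺t)

  between-trichotomy : x ∈ q → m ∈ q → y ∈ q → x ≢ m → m ≢ y → x ≢ y →
    Between q x m y ⊎ Between q m x y ⊎ Between q x y m
  between-trichotomy x∈ m∈ y∈ x≢m m≢y x≢y
    with ≺-total x∈ m∈ x≢m | ≺-total m∈ y∈ m≢y | ≺-total x∈ y∈ x≢y
  ... | inj₁ x≺m | inj₁ m≺y | _        = inj₁ (inj₁ (x≺m , m≺y))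
  ... | inj₂ m≺x | inj₂ y≺m | _        = inj₁ (inj₂ (y≺m , m≺x))
  ... | inj₁ x≺m | inj₂ y≺m | inj₁ x≺y = inj₂ (inj₂ (inj₁ (x≺y , y≺m)))
  ... | inj₁ x≺m | inj₂ y≺m | inj₂ y≺x = inj₂ (inj₁ (inj₂ (y≺x , x≺m)))
  ... | inj₂ m≺x | inj₁ m≺y | inj₁ x≺y = inj₂ (inj₁ (inj₁ (m≺x , x≺y)))
  ... | inj₂ m≺x | inj₁ m≺y | inj₂ y≺x = inj₂ (inj₂ (inj₂ (m≺y , y≺x)))

  onSegment-start : t ∈ q → b ∈ q → OnSegment q t b t
  onSegment-start t∈ b∈ = Sum.map (inj₁ refl ,_) (_, inj₁ refl) (≼-total t∈ b∈)

  onSegment-either-side : t ∈ q → Between q u v w → OnSegment q t u v ⊎ OnSegment q t w v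
  onSegment-either-side t∈ (inj₁ (u≺v , v≺w)) with ≼-total t∈ (≺⇒∈ˡ v≺w)
  ... | inj₁ t≼v = inj₂ (inj₁ (t≼v , inj₂ v≺w))
  ... | inj₂ v≼t = inj₁ (inj₂ (inj₂ u≺v , v≼t))
  onSegment-either-side t∈ (inj₂ (w≺v , v≺u)) = Sum.swap (onSegment-either-side t∈ (inj₁ (w≺v , v≺u)))

  -- v lies on the segment from the peak of ω to whichever of u, w is on the other side of v.
  between-not-last : Unique q → ω ↭ q → SinglePeaked q ω → Between q u v w → v ≺[ ω ] u ⊎ v ≺[ ω ] w
  between-not-last {ω = []} _ ω↭q _ between with () ← ∈-resp-↭ (↭-sym ω↭q) (between⇒∈ between)
  between-not-last {q} {t ∷ r} q-unique ω↭q peaked between =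
    Sum.map (peaked t r refl _ _ (v≢ between)) (peaked t r refl _ _ (v≢ (Sum.swap between)))
            (onSegment-either-side (∈-resp-↭ ω↭q (here refl)) between)
    where
    v≢ : Between q u v w → v ≢ u
    v≢ (inj₁ (u≺v , _)) = ≺⇒≢ q-unique u≺v ∘ sym
    v≢ (inj₂ (_ , v≺u)) = ≺⇒≢ q-unique v≺u

  module _ {P q : List X} (P-unique : Unique P) (P↭q : P ↭ q)
           (P-peaked : SinglePeaked q P) (P⃖-peaked : SinglePeaked q (reverse P)) where

    private
      q-unique : Unique q
      q-unique = unique-resp-↭ P↭q P-unique

      ∈q : a ∈ P → a ∈ q
      ∈q = ∈-resp-↭ P↭q

    ≺≺⇒between : x ≺[ P ] m → m ≺[ P ] y → Between q x m y
    ≺≺⇒between {x} {m} {y} x≺m m≺y =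
      m-between (between-trichotomy (∈q (≺⇒∈ˡ x≺m)) (∈q (≺⇒∈ʳ x≺m)) (∈q (≺⇒∈ʳ m≺y))
                                    (≺⇒≢ P-unique x≺m) (≺⇒≢ P-unique m≺y) (≺⇒≢ P-unique x≺y))
      where
      x≺y : x ≺[ P ] y
      x≺y = ≺-trans P-unique x≺m m≺y

      -- If x (resp. y) were the q-middle, reverse P (resp. P) would rank a middle last.
      m-between : Between q x m y ⊎ Between q m x y ⊎ Between q x y m → Between q x m y
      m-between (inj₁ between) = between
      m-between (inj₂ (inj₁ x-between)) =
        ⊥-elim (Sum.[ ≺-asym P-unique x≺m ∘ ≺-reverse⁻ , ≺-asym P-unique x≺y ∘ ≺-reverse⁻ ]
                  (between-not-last q-unique (↭-trans (↭-reverse P) P↭q) P⃖-peaked x-between))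
      m-between (inj₂ (inj₂ y-between)) =
        ⊥-elim (Sum.[ ≺-asym P-unique x≺y , ≺-asym P-unique m≺y ]
                  (between-not-last q-unique P↭q P-peaked y-between))

    onSegment-transfer : a ≢ b → OnSegment P t b a → OnSegment q t b a
    onSegment-transfer a≢b (inj₁ (_ , inj₁ a≡b))          = ⊥-elim (a≢b a≡b)
    onSegment-transfer _   (inj₁ (inj₁ refl , inj₂ a≺b))  = onSegment-start (∈q (≺⇒∈ˡ a≺b)) (∈q (≺⇒∈ʳ a≺b))
    onSegment-transfer _   (inj₁ (inj₂ t≺a , inj₂ a≺b))  = between⇒onSegment (≺≺⇒between t≺a a≺b)
    onSegment-transfer a≢b (inj₂ (inj₁ b≡a , _))          = ⊥-elim (a≢b (sym b≡a))
    onSegment-transfer _   (inj₂ (inj₂ b≺a , inj₁ refl))  = onSegment-start (∈q (≺⇒∈ʳ b≺a)) (∈q (≺⇒∈ˡ b≺a))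
    onSegment-transfer _   (inj₂ (inj₂ b≺a , inj₂ a≺t))  = between⇒onSegment (Sum.swap (≺≺⇒between b≺a a≺t))

    singlePeaked-transfer : SinglePeaked q ω → SinglePeaked P ω
    singlePeaked-transfer peaked t r eq a b a≢b on-ab = peaked t r eq a b a≢b (onSegment-transfer a≢b on-ab)

  module _ {P : Pred X 0ℓ} (P? : Decidable P) where

    ≺-filter⁺ : P a → P b → a ≺[ l ] b → a ≺[ filter P? l ] b
    ≺-filter⁺ {a} Pa Pb (xs , ys , refl , b∈ys) =
      filter P? xs , filter P? ys , split , ∈-filter⁺ P? b∈ys Pb
      where
      split : filter P? (xs ++ a ∷ ys) ≡ filter P? xs ++ a ∷ filter P? ys
      split = trans (filter-++ P? xs (a ∷ ys)) (cong (filter P? xs ++_) (filter-accept P? Pa))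

    ≺-filter⁻ : a ≺[ filter P? l ] b → a ≺[ l ] b
    ≺-filter⁻ {l = []} a≺b = a≺b
    ≺-filter⁻ {l = x ∷ l} a≺b with P? x
    ... | no _ = ≺-there (≺-filter⁻ a≺b)
    ... | yes _ with ≺-∷⁻ a≺b
    ...   | inj₁ (refl , b∈l) = ≺-here (proj₁ (∈-filter⁻ P? b∈l))
    ...   | inj₂ a≺b′ = ≺-there (≺-filter⁻ a≺b′)

    ≼-filter⁺ : P a → P b → a ≼[ l ] b → a ≼[ filter P? l ] b
    ≼-filter⁺ _  _  (inj₁ a≡b) = inj₁ a≡b
    ≼-filter⁺ Pa Pb (inj₂ a≺b) = inj₂ (≺-filter⁺ Pa Pb a≺b)

    ≼-filter⁻ : a ≼[ filter P? l ] b → a ≼[ l ] b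
    ≼-filter⁻ (inj₁ a≡b) = inj₁ a≡b
    ≼-filter⁻ (inj₂ a≺b) = inj₂ (≺-filter⁻ a≺b)

    onSegment-filter⁺ : P t → P b → P a → OnSegment p t b a → OnSegment (filter P? p) t b a
    onSegment-filter⁺ Pt Pb Pa = Sum.map (λ (t≼a , a≼b) → ≼-filter⁺ Pt Pa t≼a , ≼-filter⁺ Pa Pb a≼b)
                                         (λ (b≼a , a≼t) → ≼-filter⁺ Pb Pa b≼a , ≼-filter⁺ Pa Pt a≼t)

    onSegment-filter⁻ : OnSegment (filter P? p) t b a → OnSegment p t b a
    onSegment-filter⁻ = Sum.map (λ (t≼a , a≼b) → ≼-filter⁻ t≼a , ≼-filter⁻ a≼b)
                                (λ (b≼a , a≼t) → ≼-filter⁻ b≼a , ≼-filter⁻ a≼t)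

    singlePeaked-filter : SinglePeaked p (t ∷ r) → P t → SinglePeaked (filter P? p) (filter P? (t ∷ r))
    singlePeaked-filter {p} {t} {r} peaked Pt top _ eq a b a≢b on-ab
      with refl ← ∷-injectiveˡ (trans (sym (filter-accept P? Pt)) eq) =
      ≺-filter⁺ Pa Pb (peaked t r refl a b a≢b (onSegment-filter⁻ on-ab))
      where
      Pa : P a
      Pa with onSegment⇒≡∨∈ on-ab
      ... | inj₁ refl = Pt
      ... | inj₂ a∈p = proj₂ (∈-filter⁻ P? {xs = p} a∈p)
      Pb : P b
      Pb = proj₂ (∈-filter⁻ P? {xs = p} (onSegment⇒∈ a≢b on-ab))

  ∈-∖⁺ : a ∈ l → a ≢ c → a ∈ l ∖ c
  ∈-∖⁺ {c = c} = ∈-filter⁺ (≢-dec c)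

  ∈-∖⁻ : a ∈ l ∖ c → a ∈ l × a ≢ c
  ∈-∖⁻ {l = l} {c} = ∈-filter⁻ (≢-dec c) {xs = l}

  ∖-∉ : c ∉ l → l ∖ c ≡ l
  ∖-∉ {c} c∉l = filter-all (≢-dec c) (All.tabulate λ { a∈l refl → c∉l a∈l })

  ∖-∷ʳ : c ∉ l → (l ∷ʳ c) ∖ c ≡ l
  ∖-∷ʳ {c} {l} c∉l = begin
    (l ++ [ c ]) ∖ c     ≡⟨ filter-++ (≢-dec c) l [ c ] ⟩
    l ∖ c ++ [ c ] ∖ c   ≡⟨ cong (l ∖ c ++_) (filter-reject (≢-dec c) (λ c≢c → c≢c refl)) ⟩
    l ∖ c ++ []          ≡⟨ ++-identityʳ (l ∖ c) ⟩
    l ∖ c                ≡⟨ ∖-∉ c∉l ⟩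
    l                    ∎
    where open ≡-Reasoning

  ∖-unique : Unique l → Unique (l ∖ c)
  ∖-unique {c = c} = filter⁺ (≢-dec c)

  ∖-↭ : l ↭ r → l ∖ c ↭ r ∖ c
  ∖-↭ {c = c} = filter-↭ (≢-dec c)

  ↭-∷∖ : Unique l → c ∈ l → l ↭ c ∷ l ∖ c
  ↭-∷∖ {x ∷ l} {c} (x∉l ∷ l-unique) c∈ with x ≟ c | c∈
  ... | yes refl | _          = prep x (↭-reflexive (sym (∖-∉ (Unique[x∷xs]⇒x∉xs (x∉l ∷ l-unique)))))
  ... | no x≢c   | here refl  = ⊥-elim (x≢c refl)
  ... | no _     | there c∈l  = ↭-trans (prep x (↭-∷∖ l-unique c∈l)) (swap x c ↭-refl)

  ∷ʳ-↭ : Unique l → c ∈ l → ω ↭ l ∖ c → ω ∷ʳ c ↭ l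
  ∷ʳ-↭ {ω = ω} l-unique c∈l ω↭ =
    ↭-trans (↭-sym (∷↭∷ʳ _ ω)) (↭-trans (prep _ ω↭) (↭-sym (↭-∷∖ l-unique c∈l)))

  SinglePeakedDomain : List X → List X → Pred (List X) 0ℓ
  SinglePeakedDomain A p ω = IsPref _≟_ A ω × SinglePeaked p ω

  private variable
    A : List X
    D : Pred (List X) 0ℓ

  maximal⇒≐singlePeakedDomain : IsMaximalBSPD _≟_ A D → ∃ λ p → p ↭ A × D ≐ SinglePeakedDomain A p
  maximal⇒≐singlePeakedDomain {A} {D} ((D-pref , p , p↭A , D-peaked) , D-maximal) =
    p , p↭A , (λ {ω} ω∈D → D-pref ω ω∈D , D-peaked ω ω∈D) ,
              (λ {ω} → D-maximal D⁺ D⁺-bspd (λ _ → inj₁) ω ∘ inj₂)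
    where
    D⁺ : Pred (List X) 0ℓ
    D⁺ = D ∪ SinglePeakedDomain A p

    D⁺-bspd : IsBSPD _≟_ A D⁺
    D⁺-bspd = (λ ω → Sum.[ D-pref ω , proj₁ ]) , p , p↭A , (λ ω → Sum.[ D-peaked ω , proj₂ ])

  ≐singlePeakedDomain⇒maximal : Unique A → p ↭ A → D ≐ SinglePeakedDomain A p → IsMaximalBSPD _≟_ A D
  ≐singlePeakedDomain⇒maximal {A} {p} {D} A-unique p↭A (D⊆ , ⊆D) =
    ((λ _ → proj₁ ∘ D⊆) , p , p↭A , (λ _ → proj₂ ∘ D⊆)) , maximal
    where
    p-unique : Unique p
    p-unique = unique-resp-↭ (↭-sym p↭A) A-unique

    maximal : (D′ : Pred (List X) 0ℓ) → IsBSPD _≟_ A D′ → (∀ ω → D ω → D′ ω) → ∀ ω → D′ ω → D ω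
    maximal D′ (D′-pref , q , q↭A , D′-peaked) D⊆D′ ω ω∈D′ =
      ⊆D (D′-pref ω ω∈D′ , singlePeaked-transfer p-unique p↭q (in-D′ p p-spd) (in-D′ (reverse p) p⃖-spd)
                               (D′-peaked ω ω∈D′))
      where
      p↭q : p ↭ q
      p↭q = ↭-trans p↭A (↭-sym q↭A)

      in-D′ : ∀ ω → SinglePeakedDomain A p ω → SinglePeaked q ω
      in-D′ ω ω∈ = D′-peaked ω (D⊆D′ ω (⊆D ω∈))

      p-spd : SinglePeakedDomain A p p
      p-spd = p↭A , singlePeaked-self p-unique

      p⃖-spd : SinglePeakedDomain A p (reverse p)
      p⃖-spd = ↭-trans (↭-reverse p) p↭A , singlePeaked-reverse p-unique

  Interior : List X → X → Set
  Interior p c = ∃₂ λ x y → x ≺[ p ] c × c ≺[ p ] y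

  IsEndpoint : List X → X → Set
  IsEndpoint p c = c ∈ p × ¬ Interior p c

  onSegment⇒interior : t ≢ a → b ≢ a → OnSegment p t b a → Interior p a
  onSegment⇒interior t≢a _   (inj₁ (inj₁ t≡a , _))        = ⊥-elim (t≢a t≡a)
  onSegment⇒interior _   b≢a (inj₁ (_ , inj₁ a≡b))        = ⊥-elim (b≢a (sym a≡b))
  onSegment⇒interior _   _   (inj₁ (inj₂ t≺a , inj₂ a≺b)) = _ , _ , t≺a , a≺b
  onSegment⇒interior _   b≢a (inj₂ (inj₁ b≡a , _))        = ⊥-elim (b≢a b≡a)
  onSegment⇒interior t≢a _   (inj₂ (_ , inj₁ a≡t))        = ⊥-elim (t≢a (sym a≡t))
  onSegment⇒interior _   _   (inj₂ (inj₂ b≺a , inj₂ a≺t)) = _ , _ , b≺a , a≺t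

  last⇒endpoint : ∀ xs → Unique p → xs ∷ʳ c ↭ p → SinglePeaked p (xs ∷ʳ c) → IsEndpoint p c
  last⇒endpoint {c = c} xs p-unique ω↭p peaked =
    ∈-resp-↭ ω↭p (∈-++⁺ʳ xs (here refl)) ,
    λ (_ , _ , x≺c , c≺y) → Sum.[ ≺-last⁻ xs ω-unique , ≺-last⁻ xs ω-unique ]
                               (between-not-last p-unique ω↭p peaked (inj₁ (x≺c , c≺y)))
    where
    ω-unique : Unique (xs ∷ʳ c)
    ω-unique = unique-resp-↭ (↭-sym ω↭p) p-unique

  endpoint-∖ : c ≢ a → IsEndpoint p c → IsEndpoint (p ∖ a) c
  endpoint-∖ {a = a} c≢a (c∈p , not-interior) =
    ∈-∖⁺ c∈p c≢a ,
    λ (x , y , x≺c , c≺y) → not-interior (x , y , ≺-filter⁻ (≢-dec a) x≺c , ≺-filter⁻ (≢-dec a) c≺y)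

  singlePeaked-init : ∀ xs → Unique (xs ∷ʳ c) → SinglePeaked p (xs ∷ʳ c) → SinglePeaked (p ∖ c) xs
  singlePeaked-init [] _ _ _ _ ()
  singlePeaked-init {c} {p} (t ∷ r) unique peaked =
    subst (SinglePeaked (p ∖ c)) (∖-∷ʳ c∉)
          (singlePeaked-filter (≢-dec c) peaked (λ t≡c → c∉ (here (sym t≡c))))
    where
    c∉ : c ∉ t ∷ r
    c∉ = ∷ʳ-unique⇒∉ (t ∷ r) unique

  singlePeaked-∷ʳ : ¬ Interior p c → ω ↭ p ∖ c → SinglePeaked (p ∖ c) ω → SinglePeaked p (ω ∷ʳ c)
  singlePeaked-∷ʳ {p} {c} {[]} _ ω↭ _ .c .[] refl a b a≢b on-ab =
    ⊥-elim (a≢b (trans (Sum.[ id , only-c ] (onSegment⇒≡∨∈ on-ab))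
                       (sym (only-c (onSegment⇒∈ a≢b on-ab)))))
    where
    only-c : x ∈ p → x ≡ c
    only-c {x} x∈p with x ≟ c
    ... | yes x≡c = x≡c
    ... | no x≢c with () ← ∈-resp-↭ (↭-sym ω↭) (∈-∖⁺ x∈p x≢c)
  singlePeaked-∷ʳ {p} {c} {t ∷ r} not-interior ω↭ peaked .t .(r ∷ʳ c) refl a b a≢b on-ab
    with proj₂ (∈-∖⁻ {l = p} (∈-resp-↭ ω↭ (here refl))) | b ≟ c | a ≟ c
  ... | _   | yes refl | _        = ≺-∷ʳ a∈ω
    where
    a∈ω : a ∈ t ∷ r
    a∈ω with onSegment⇒≡∨∈ on-ab
    ... | inj₁ refl = here refl
    ... | inj₂ a∈p  = ∈-resp-↭ (↭-sym ω↭) (∈-∖⁺ a∈p a≢b)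
  ... | t≢c | no b≢c   | yes refl = ⊥-elim (not-interior (onSegment⇒interior t≢c b≢c on-ab))
  ... | t≢c | no b≢c   | no a≢c   =
    ≺-++ʳ [ c ] (peaked t r refl a b a≢b (onSegment-filter⁺ (≢-dec c) t≢c b≢c a≢c on-ab))

  bottom⇒endpoint : Unique A → p ↭ A → D ≐ SinglePeakedDomain A p → IsBottom _≟_ D c → IsEndpoint p c
  bottom⇒endpoint A-unique p↭A (D⊆ , _) (_ , ω∈D , xs , refl) with D⊆ ω∈D
  ... | ω↭A , ω-peaked =
    last⇒endpoint xs (unique-resp-↭ (↭-sym p↭A) A-unique) (↭-trans ω↭A (↭-sym p↭A)) ω-peaked

  bottomRestrict-≐ : Unique A → p ↭ A → D ≐ SinglePeakedDomain A p → IsEndpoint p c →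
    BottomRestrict _≟_ D c ≐ SinglePeakedDomain (A ∖ c) (p ∖ c)
  bottomRestrict-≐ {A} {p} {D} {c} A-unique p↭A (D⊆ , ⊆D) (c∈p , not-interior) = restrict , extend
    where
    restrict : BottomRestrict _≟_ D c ⊆ SinglePeakedDomain (A ∖ c) (p ∖ c)
    restrict (_ , ω∈D , (xs , refl) , refl) with D⊆ ω∈D
    ... | ω↭A , ω-peaked =
      ∖-↭ ω↭A , subst (SinglePeaked (p ∖ c)) (sym (∖-∷ʳ (∷ʳ-unique⇒∉ xs ω-unique)))
                      (singlePeaked-init xs ω-unique ω-peaked)
      where
      ω-unique : Unique (xs ∷ʳ c)
      ω-unique = unique-resp-↭ (↭-sym ω↭A) A-unique

    extend : SinglePeakedDomain (A ∖ c) (p ∖ c) ⊆ BottomRestrict _≟_ D c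
    extend {ω} (ω↭ , ω-peaked) =
      ω ∷ʳ c , ⊆D (∷ʳ-↭ A-unique (∈-resp-↭ p↭A c∈p) ω↭ ,
                   singlePeaked-∷ʳ not-interior (↭-trans ω↭ (↭-sym (∖-↭ p↭A))) ω-peaked) ,
      (ω , refl) , sym (∖-∷ʳ c∉ω)
      where
      c∉ω : c ∉ ω
      c∉ω c∈ω = proj₂ (∈-∖⁻ {l = A} (∈-resp-↭ ω↭ c∈ω)) refl

  bottomRestrict₂-≐ : D ⊆ Unique →
    BottomRestrict₂ _≟_ D a b ≐ BottomRestrict _≟_ (BottomRestrict _≟_ D a) b
  bottomRestrict₂-≐ {D} {a} {b} D-unique = split , merge
    where
    reassociate : ∀ xs → xs ++ b ∷ a ∷ [] ≡ (xs ∷ʳ b) ∷ʳ a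
    reassociate xs = sym (++-assoc xs [ b ] [ a ])

    split : BottomRestrict₂ _≟_ D a b ⊆ BottomRestrict _≟_ (BottomRestrict _≟_ D a) b
    split (ω , ω∈D , (xs , refl) , refl) =
      ω ∖ a , (ω , ω∈D , (xs ∷ʳ b , reassociate xs) , refl) , (xs , ω∖a≡) , refl
      where
      ω∖a≡ : ω ∖ a ≡ xs ∷ʳ b
      ω∖a≡ = trans (cong (_∖ a) (reassociate xs))
                   (∖-∷ʳ (∷ʳ-unique⇒∉ (xs ∷ʳ b) (subst Unique (reassociate xs) (D-unique ω∈D))))

    merge : BottomRestrict _≟_ (BottomRestrict _≟_ D a) b ⊆ BottomRestrict₂ _≟_ D a b
    merge (_ , (ω , ω∈D , (xs , refl) , refl) , (ys , ω∖a≡) , refl) =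
      ω , ω∈D , (ys , trans (cong (_∷ʳ a) xs≡) (sym (reassociate ys))) , refl
      where
      xs≡ : xs ≡ ys ∷ʳ b
      xs≡ = trans (sym (∖-∷ʳ (∷ʳ-unique⇒∉ xs (D-unique ω∈D)))) ω∖a≡

corollary2p29 : {X : Set} (_≟_ : DecidableEquality X) (A : List X) → Unique A → length A ≥ 3 →
    (D : List X → Set) → IsMaximalBSPD _≟_ A D →
    (a₁ a₂ : X) → a₁ ≢ a₂ → IsBottom _≟_ D a₁ → IsBottom _≟_ D a₂ →
    IsMaximalBSPD _≟_ (remove _≟_ a₁ A) (BottomRestrict _≟_ D a₁)
    × IsMaximalBSPD _≟_ (remove _≟_ a₂ A) (BottomRestrict _≟_ D a₂)
    × IsMaximalBSPD _≟_ (remove _≟_ a₂ (remove _≟_ a₁ A)) (BottomRestrict₂ _≟_ D a₁ a₂)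
corollary2p29 _≟_ A A-unique _ D D-maximal a₁ a₂ a₁≢a₂ a₁-bottom a₂-bottom
  with p , p↭A , D≐ ← BlackSinglePeaked.maximal⇒≐singlePeakedDomain _≟_ D-maximal =
  ≐singlePeakedDomain⇒maximal (∖-unique A-unique) (∖-↭ p↭A) (D∖≐ a₁-endpoint) ,
  ≐singlePeakedDomain⇒maximal (∖-unique A-unique) (∖-↭ p↭A) (D∖≐ a₂-endpoint) ,
  ≐singlePeakedDomain⇒maximal (∖-unique (∖-unique A-unique)) (∖-↭ (∖-↭ p↭A)) D₁₂≐
  where
  open BlackSinglePeaked _≟_

  a₁-endpoint : IsEndpoint p a₁
  a₁-endpoint = bottom⇒endpoint A-unique p↭A D≐ a₁-bottom

  a₂-endpoint : IsEndpoint p a₂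
  a₂-endpoint = bottom⇒endpoint A-unique p↭A D≐ a₂-bottom

  D∖≐ : ∀ {c} → IsEndpoint p c → BottomRestrict _≟_ D c ≐ SinglePeakedDomain (A ∖ c) (p ∖ c)
  D∖≐ = bottomRestrict-≐ A-unique p↭A D≐

  D-unique : D ⊆ Unique
  D-unique ω∈D = unique-resp-↭ (↭-sym (proj₁ (proj₁ D≐ ω∈D))) A-unique

  D₁₂≐ : BottomRestrict₂ _≟_ D a₁ a₂ ≐ SinglePeakedDomain (A ∖ a₁ ∖ a₂) (p ∖ a₁ ∖ a₂)
  D₁₂≐ = ≐-trans (bottomRestrict₂-≐ D-unique)
                 (bottomRestrict-≐ (∖-unique A-unique) (∖-↭ p↭A) (D∖≐ a₁-endpoint)
                                   (endpoint-∖ (a₁≢a₂ ∘ sym) a₂-endpoint))
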